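{- Let $D=(V,A)$ be a finite, connected, acyclic digraph admitting a U-coloring. Then $D$ has a unique sink.
   Context: For a digraph $D=(V,A)$, an arc coloring $c$ is a U-coloring if for all $u,v,w\in V$ with $u\neq w$ and $(v,u),(v,w)\in A$: (U$_1$) $c(v,u)\neq c(v,w)$; (U$_2$) there is $z\in V$ with arcs $(u,z),(w,z)\in A$ such that $c(v,u)=c(w,z)$ and $c(v,w)=c(u,z)$. -}

module Defs where

open import Data.Nat using (ℕ)
open import Data.Fin using (Fin)
open import Data.Bool using (Bool; true)
open import Data.Product using (Σ; _×_; ∃; ∃-syntax)
open import Data.Sum using (_⊎_)
open import Relation.Nullary using (¬_)
open import Relation.Binary.PropositionalEquality using (_≡_)
open import Relation.Binary.Construct.Closure.Transitive using (TransClosure)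
open import Relation.Binary.Construct.Closure.ReflexiveTransitive using (Star)

record Digraph (n : ℕ) : Set where
  field
    arc : Fin n → Fin n → Bool

module _ {n : ℕ} (D : Digraph n) where
  open Digraph D

  Arc : Fin n → Fin n → Set
  Arc u v = arc u v ≡ true

  UArc : Fin n → Fin n → Set
  UArc u v = Arc u v ⊎ Arc v u

  Connected : Set
  Connected = ∀ (u v : Fin n) → Star UArc u v

  Acyclic : Set
  Acyclic = ∀ (v : Fin n) → ¬ TransClosure Arc v v

  IsSink : Fin n → Set
  IsSink v = ∀ (w : Fin n) → ¬ Arc v w

  -- U-coloring: an arc coloring c (colors in an arbitrary type C; c is only
  -- consulted on arcs)
  IsUColoring : {C : Set} → (Fin n → Fin n → C) → Set
  IsUColoring c =
    ∀ (u v w : Fin n) → ¬ (u ≡ w) → Arc v u → Arc v w →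
      (¬ (c v u ≡ c v w))
      × (∃[ z ] (Arc u z × Arc w z × (c v u ≡ c w z) × (c v w ≡ c u z)))

  HasUColoring : Set₁
  HasUColoring = Σ Set λ C → Σ (Fin n → Fin n → C) λ c → IsUColoring c

-- A finite acyclic digraph is terminating, and condition (U₂) of a U-coloring
-- makes it locally confluent: two arcs out of a vertex end in a common
-- out-neighbour. By Newman's lemma every vertex then reaches exactly one sink,
-- and this sink does not change along arcs in either direction; connectivity
-- therefore makes all sinks equal, while termination provides one.
module Submission where

open import Defs
open import Level using (Level)
open import Data.Nat using (ℕ; suc)
open import Data.Fin using (Fin; zero; _≟_)
open import Data.Fin.Properties using (any?)
open import Data.Fin.Induction using (spo-noetherian)
open import Data.Bool using (true) renaming (_≟_ to _≟ᵇ_)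
open import Data.Product using (∃; ∃-syntax; ∃!; _×_; _,_; proj₁; proj₂)
open import Data.Sum using (_⊎_; inj₁; inj₂)
open import Data.Empty using (⊥-elim)
open import Function using (flip)
open import Induction.WellFounded using (WellFounded; Acc; acc; module Subrelation)
open import Relation.Nullary using (¬_; yes; no)
open import Relation.Binary.Core using (Rel)
open import Relation.Binary.Structures using (IsStrictPartialOrder)
open import Relation.Binary.PropositionalEquality
  using (_≡_; refl; sym; trans; isEquivalence; resp₂; module ≡-Reasoning)
open import Relation.Binary.Construct.Closure.Transitive
  using (TransClosure; [_]; transitive)
open import Relation.Binary.Construct.Closure.ReflexiveTransitive
  using (Star; ε; _◅_; _◅◅_; fold)

module NormalForms {a ℓ : Level} {A : Set a} (_⟶_ : Rel A ℓ) where

  _⟶*_ : Rel A _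
  _⟶*_ = Star _⟶_

  _⇄_ : Rel A _
  x ⇄ y = x ⟶ y ⊎ y ⟶ x

  Normal : A → Set _
  Normal x = ∀ y → ¬ (x ⟶ y)

  LocallyConfluent : Set _
  LocallyConfluent = ∀ {x y z} → x ⟶ y → x ⟶ z → ∃[ w ] y ⟶* w × z ⟶* w

  module _ (terminating : WellFounded (flip _⟶_))
           (reducible? : ∀ x → ∃ (x ⟶_) ⊎ Normal x) where

    reachesNormal : ∀ x → ∃[ s ] Normal s × x ⟶* s
    reachesNormal x = go (terminating x)
      where
      go : ∀ {x} → Acc (flip _⟶_) x → ∃[ s ] Normal s × x ⟶* s
      go {x} (acc rs) with reducible? x
      ... | inj₂ x-normal = x , x-normal , ε
      ... | inj₁ (y , x⟶y) =
        let s , s-normal , y⟶*s = go (rs x⟶y) in s , s-normal , x⟶y ◅ y⟶*s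

    module _ (locallyConfluent : LocallyConfluent) where

      -- Newman's lemma: the two reductions are joined at a normal form of a
      -- common reduct, and the induction hypothesis applies to both first steps.
      normal-unique : ∀ {x s t} → Normal s → Normal t → x ⟶* s → x ⟶* t → s ≡ t
      normal-unique {x} = go (terminating x)
        where
        go : ∀ {x s t} → Acc (flip _⟶_) x →
             Normal s → Normal t → x ⟶* s → x ⟶* t → s ≡ t
        go _ _ _ ε ε = refl
        go _ s-normal _ ε (x⟶z ◅ _) = ⊥-elim (s-normal _ x⟶z)
        go _ _ t-normal (x⟶y ◅ _) ε = ⊥-elim (t-normal _ x⟶y)
        go (acc rs) s-normal t-normal (x⟶y ◅ y⟶*s) (x⟶z ◅ z⟶*t) =
          let w , y⟶*w , z⟶*w = locallyConfluent x⟶y x⟶z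
              r , r-normal , w⟶*r = reachesNormal w
          in trans (go (rs x⟶y) s-normal r-normal y⟶*s (y⟶*w ◅◅ w⟶*r))
                   (sym (go (rs x⟶z) t-normal r-normal z⟶*t (z⟶*w ◅◅ w⟶*r)))

      normalForm : A → A
      normalForm x = proj₁ (reachesNormal x)

      normalForm-⇄ : ∀ {x y} → x ⇄ y → normalForm x ≡ normalForm y
      normalForm-⇄ {x} {y} (inj₁ x⟶y) =
        let _ , x-nf , x⟶*nf = reachesNormal x
            _ , y-nf , y⟶*nf = reachesNormal y
        in normal-unique x-nf y-nf x⟶*nf (x⟶y ◅ y⟶*nf)
      normalForm-⇄ (inj₂ y⟶x) = sym (normalForm-⇄ (inj₁ y⟶x))

      normalForm-normal : ∀ {s} → Normal s → normalForm s ≡ s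
      normalForm-normal {s} s-normal =
        let _ , s-nf , s⟶*nf = reachesNormal s
        in normal-unique s-nf s-normal s⟶*nf ε

      normal-convertible-≡ : ∀ {s t} → Normal s → Normal t → Star _⇄_ s t → s ≡ t
      normal-convertible-≡ {s} {t} s-normal t-normal s⇄*t = begin
        s              ≡⟨ normalForm-normal s-normal ⟨
        normalForm s   ≡⟨ fold (λ x y → normalForm x ≡ normalForm y)
                               (λ x⇄y → trans (normalForm-⇄ x⇄y)) refl s⇄*t ⟩
        normalForm t   ≡⟨ normalForm-normal t-normal ⟩
        t              ∎
        where open ≡-Reasoning

module _ {n : ℕ} (D : Digraph n) where
  open NormalForms (Arc D)

  acyclic⇒terminating : Acyclic D → WellFounded (flip (Arc D))
  acyclic⇒terminating acyclic = Subrelation.wellFounded [_] (spo-noetherian isSPO)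
    where
    isSPO : IsStrictPartialOrder _≡_ (TransClosure (Arc D))
    isSPO = record
      { isEquivalence = isEquivalence
      ; irrefl        = λ { refl → acyclic _ }
      ; trans         = transitive (Arc D)
      ; <-resp-≈      = resp₂ _
      }

  hasArc⊎sink : ∀ v → ∃ (Arc D v) ⊎ IsSink D v
  hasArc⊎sink v with any? (λ w → Digraph.arc D v w ≟ᵇ true)
  ... | yes v⟶w = inj₁ v⟶w
  ... | no no-arc = inj₂ (λ w v⟶w → no-arc (w , v⟶w))

  uColoring⇒locallyConfluent : {C : Set} {c : Fin n → Fin n → C} →
                               IsUColoring D c → LocallyConfluent
  uColoring⇒locallyConfluent uColoring {v} {u} {w} v⟶u v⟶w with u ≟ w
  ... | yes refl = u , ε , ε
  ... | no u≢w =
    let z , u⟶z , w⟶z , _ = proj₂ (uColoring u v w u≢w v⟶u v⟶w)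
    in z , u⟶z ◅ ε , w⟶z ◅ ε

proposition1 : (n : ℕ) (D : Digraph (suc n)) → Connected D → Acyclic D → HasUColoring D →
    ∃! _≡_ (IsSink D)
proposition1 n D connected acyclic (_ , _ , uColoring) =
  let s , s-sink , _ = reachesNormal terminating (hasArc⊎sink D) zero
  in s , s-sink , λ {t} t-sink →
       normal-convertible-≡ terminating (hasArc⊎sink D) locallyConfluent
                            s-sink t-sink (connected s t)
  where
  open NormalForms (Arc D)

  terminating : WellFounded (flip (Arc D))
  terminating = acyclic⇒terminating D acyclic

  locallyConfluent : LocallyConfluent
  locallyConfluent = uColoring⇒locallyConfluent D uColoring
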